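{- Let $\mathcal{H}$ be a finite hypergraph with maximal vertex degree $\Delta$, such that every hyperedge of $\mathcal{H}$ contains at least $\delta$ vertices, where $\delta \ge 2$. Let $k = \lceil 2\Delta/\delta \rceil$. Then there exists an image $G$ of $\mathcal{H}$ with $\Delta(G) \le k$.
   Context: A hypergraph $\mathcal{H}$ consists of a vertex set $V(\mathcal{H})$ and a family $E(\mathcal{H})$ of subsets of $V(\mathcal{H})$ called hyperedges; the degree of a vertex is the number of hyperedges containing it, and $\Delta$ is the maximum degree. A graph $G$ (multiple edges allowed, no loops) is called an image of $\mathcal{H}$ if $V(G) = V(\mathcal{H})$ and there exists a bijection $\varphi: E(G) \to E(\mathcal{H})$ such that for every edge $e \in E(G)$ the two endpoints of $e$ lie in the hyperedge $\varphi(e)$. Multiple edges of $G$ corresponding to distinct hyperedges are counted as distinct edges, and $\Delta(G)$ is the maximum vertex degree of $G$ counting edge multiplicities. -}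

module Defs where

open import Data.Nat using (ℕ; zero; suc; _+_; _*_; _∸_; _⊔_; _≤_; _/_; NonZero)
import Data.Fin as Fin
open Fin using (Fin)
open import Data.Fin.Subset using (Subset; _∈_; ∣_∣)
open import Data.Product using (_×_; proj₁; proj₂)
open import Data.Bool using (Bool; true; false)
open import Relation.Nullary using (¬_; does)
open import Relation.Binary.PropositionalEquality using (_≡_)
open import Data.Fin.Properties using (_≟_)
open import Data.Fin.Subset.Properties using (_∈?_)

-- A finite hypergraph on vertex set Fin n with m hyperedges (a family,
-- indexed by Fin m; repeated hyperedges allowed).
Hypergraph : ℕ → ℕ → Set
Hypergraph n m = Fin m → Subset n

b2n : Bool → ℕ
b2n true = 1
b2n false = 0

count : ∀ {m} → (Fin m → Bool) → ℕ
count {zero}  p = 0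
count {suc m} p = b2n (p Fin.zero) + count (λ i → p (Fin.suc i))

hdeg : ∀ {n m} → Hypergraph n m → Fin n → ℕ
hdeg H v = count (λ e → does (v ∈? H e))

maxFin : ∀ {n} → (Fin n → ℕ) → ℕ
maxFin {zero}  f = 0
maxFin {suc n} f = f Fin.zero ⊔ maxFin (λ i → f (Fin.suc i))

maxDegH : ∀ {n m} → Hypergraph n m → ℕ
maxDegH H = maxFin (hdeg H)

Multigraph : ℕ → ℕ → Set
Multigraph n m = Fin m → Fin n × Fin n

Loopless : ∀ {n m} → Multigraph n m → Set
Loopless G = ∀ e → ¬ (proj₁ (G e) ≡ proj₂ (G e))

-- G is an image of H, with the bijection φ : E(G) → E(H) taken to be the
-- identity on the index set Fin m (any bijection can be absorbed by
-- reindexing the edges of G).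
IsImage : ∀ {n m} → Hypergraph n m → Multigraph n m → Set
IsImage H G = Loopless G × (∀ e → (proj₁ (G e) ∈ H e) × (proj₂ (G e) ∈ H e))

-- degree of v in G (counting multiplicities; no loops, so each incident
-- edge counts once)
gdeg : ∀ {n m} → Multigraph n m → Fin n → ℕ
gdeg G v = count (λ e → does (v ≟ proj₁ (G e)) ∨ does (v ≟ proj₂ (G e)))
  where open import Data.Bool using (_∨_)

maxDegG : ∀ {n m} → Multigraph n m → ℕ
maxDegG G = maxFin (gdeg G)

-- ceiling division ⌈a / b⌉ (only used with b ≥ 2; value 0 for b = 0)
⌈_/_⌉ : ℕ → ℕ → ℕ
⌈ a / zero ⌉ = 0
⌈ a / suc b ⌉ = (a + b) / suc b

module Submission where

-- Idea: start from any image and repair it along augmenting paths.  A step turns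
-- an edge away from an endpoint u towards another vertex x of its hyperedge,
-- moving one unit of degree from u to x.  For a vertex v of degree > k, the
-- breadth-first levels of vertices reachable from v by steps stabilise in a set S
-- closed under steps.  If S holds a vertex of degree < k, turning the edges of a
-- shortest path to it lowers the total excess of the degrees over k.  Otherwise
-- double counting the incidences of S with the edges gives
-- δ(k|S| + 1) ≤ 2Δ|S| ≤ δk|S|, which is absurd.

open import Defs
open import Data.Nat using (ℕ; >-nonZero; zero; suc; _+_; _*_; _∸_; _≤_; _<_; z≤n; s≤s; _≤?_; _<?_; _/_; _%_)
open import Data.Nat.DivMod using (m≡m%n+[m/n]*n; m%n<n)
open import Data.Nat.Properties
  using (+-comm; +-assoc; +-identityʳ; *-comm; *-identityʳ; *-identityˡ; *-zeroʳ; *-distribˡ-+;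
         +-mono-≤; +-mono-<-≤; +-monoˡ-≤; +-monoʳ-≤; *-monoʳ-≤; ∸-monoˡ-≤; ∸-monoˡ-<;
         +-cancelʳ-≤; +-cancelʳ-≡; *-cancelˡ-≤; ≤-trans; ≤-reflexive; ≤-pred; ≤-<-trans;
         <⇒≤; <⇒≱; <-irrefl; <-asym; ≮⇒≥; ≰⇒>; m≤m⊔n; m≤n⊔m; ⊔-lub; m≤n⇒m∸n≡0;
         +-commutativeSemigroup; *-commutativeSemigroup; +-*-semiring; module ≤-Reasoning)
open import Data.Fin using (Fin; punchIn)
import Data.Fin as Fin
open import Data.Fin.Properties using (_≟_; suc-injective; punchInᵢ≢i; any?; all?; ¬∀⟶∃¬)
open import Data.Fin.Subset using (Subset; _∈_; ∣_∣)
open import Data.Fin.Subset.Properties using (_∈?_; _⊂?_; p⊂q⇒∣p∣<∣q∣; ∣p∣≤n)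
open import Data.Bool using (Bool; true; false; _∨_)
open import Data.Empty using (⊥; ⊥-elim)
open import Induction.WellFounded using (Acc; acc)
open import Data.Nat.Induction using (<-wellFounded)
open import Data.Product using (Σ; ∃; ∃₂; _×_; _,_; proj₁; proj₂)
open import Data.Sum using (_⊎_; inj₁; inj₂)
open import Data.Vec using ([]; _∷_; here; there; tabulate)
open import Data.Vec.Properties using (lookup∘tabulate; lookup⇒[]=; []=⇒lookup)
open import Relation.Nullary using (¬_; Dec; yes; no; does; contradiction)
open import Relation.Nullary.Decidable using (dec-true; _⊎-dec_; _×-dec_; ¬?)
open import Relation.Unary using (Decidable)
open import Function using (_∘_)
open import Data.Vec.Functional using (updateAt)
open import Data.Vec.Functional.Properties using (updateAt-updates; updateAt-minimal)
open import Relation.Binary.PropositionalEquality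
  using (_≡_; _≢_; refl; sym; trans; cong; cong₂; subst; subst₂; module ≡-Reasoning)
open import Algebra.Properties.CommutativeSemigroup +-commutativeSemigroup
  using (xy∙z≈zy∙x; xy∙z≈xz∙y; x∙yz≈xz∙y)
open import Algebra.Properties.CommutativeSemigroup *-commutativeSemigroup
  using (x∙yz≈y∙xz)
open import Algebra.Properties.Semiring.Sum +-*-semiring
  using (sum; sum-syntax; sum-remove; sum-cong-≗; sum-replicate-zero; ∑-distrib-+; ∑-comm;
         *-distribˡ-sum; *-distribʳ-sum)

𝟙[_≡_] : ∀ {n} → Fin n → Fin n → ℕ
𝟙[ x ≡ a ] = b2n (does (x ≟ a))

𝟙[_∈_] : ∀ {n} → Fin n → Subset n → ℕ
𝟙[ x ∈ p ] = b2n (does (x ∈? p))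

𝟙[≡]-refl : ∀ {n} (a : Fin n) → 𝟙[ a ≡ a ] ≡ 1
𝟙[≡]-refl a = cong b2n (dec-true (a ≟ a) refl)

count-sum : ∀ {m} (p : Fin m → Bool) → count p ≡ ∑[ i < m ] b2n (p i)
count-sum {zero}  p = refl
count-sum {suc m} p = cong (b2n (p Fin.zero) +_) (count-sum (λ i → p (Fin.suc i)))

card-sum : ∀ {n} (p : Subset n) → ∣ p ∣ ≡ ∑[ x < n ] 𝟙[ x ∈ p ]
card-sum []          = refl
card-sum (true ∷ p)  = cong suc (card-sum p)
card-sum (false ∷ p) = card-sum p

sum-mono-≤ : ∀ {n} {f g : Fin n → ℕ} → (∀ i → f i ≤ g i) → sum f ≤ sum g
sum-mono-≤ {zero}  f≤g = z≤n
sum-mono-≤ {suc n} f≤g = +-mono-≤ (f≤g Fin.zero) (sum-mono-≤ (λ i → f≤g (Fin.suc i)))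

sum-mono-< : ∀ {n} {f g : Fin n → ℕ} → (∀ i → f i ≤ g i) → ∀ j → f j < g j → sum f < sum g
sum-mono-< {suc n} {f} {g} f≤g j fj<gj = begin-strict
  sum f                          ≡⟨ sum-remove {i = j} f ⟩
  f j + sum (λ i → f (punchIn j i)) <⟨ +-mono-<-≤ fj<gj (sum-mono-≤ (λ i → f≤g (punchIn j i))) ⟩
  g j + sum (λ i → g (punchIn j i)) ≡⟨ sum-remove {i = j} g ⟨
  sum g                          ∎
  where open ≤-Reasoning

sum-update : ∀ {m} {f g : Fin m → ℕ} e → (∀ i → i ≢ e → g i ≡ f i) → sum g + f e ≡ sum f + g e
sum-update {suc m} {f} {g} e same = begin
  sum g + f e                          ≡⟨ cong (_+ f e) (sum-remove {i = e} g) ⟩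
  g e + sum (λ i → g (punchIn e i)) + f e ≡⟨ cong (λ s → g e + s + f e) (sum-cong-≗ unchanged) ⟩
  g e + sum (λ i → f (punchIn e i)) + f e ≡⟨ xy∙z≈zy∙x (g e) _ (f e) ⟩
  f e + sum (λ i → f (punchIn e i)) + g e ≡⟨ cong (_+ g e) (sum-remove {i = e} f) ⟨
  sum f + g e                          ∎
  where
  open ≡-Reasoning
  unchanged : ∀ i → g (punchIn e i) ≡ f (punchIn e i)
  unchanged i = same (punchIn e i) (punchInᵢ≢i e i)

sum-indicator : ∀ {n} (f : Fin n → ℕ) a → ∑[ x < n ] (f x * 𝟙[ x ≡ a ]) ≡ f a
sum-indicator {suc n} f Fin.zero = trans
  (cong₂ _+_ (*-identityʳ (f Fin.zero))
             (trans (sum-cong-≗ (λ x → *-zeroʳ (f (Fin.suc x)))) (sum-replicate-zero n)))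
  (+-identityʳ (f Fin.zero))
sum-indicator {suc n} f (Fin.suc a) =
  trans (cong (_+ ∑[ x < n ] (f (Fin.suc x) * 𝟙[ x ≡ a ])) (*-zeroʳ (f Fin.zero)))
        (sum-indicator (λ x → f (Fin.suc x)) a)

sum-𝟙 : ∀ {n} (a : Fin n) → ∑[ x < n ] 𝟙[ x ≡ a ] ≡ 1
sum-𝟙 {n} a = trans (sum-cong-≗ (λ x → sym (*-identityˡ 𝟙[ x ≡ a ]))) (sum-indicator (λ _ → 1) a)

∑-weighted-comm : ∀ {n m} (w : Fin n → ℕ) (f : Fin n → Fin m → ℕ) →
                  ∑[ u < n ] (w u * ∑[ e < m ] f u e) ≡ ∑[ e < m ] ∑[ u < n ] (w u * f u e)
∑-weighted-comm {n} {m} w f =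
  trans (sum-cong-≗ (λ u → *-distribˡ-sum (w u) (f u))) (∑-comm (λ u e → w u * f u e))

≤-double : ∀ {d t} → 2 ≤ d → d ≤ t + 1 → d ≤ 2 * t
≤-double {d} {t} 2≤d d≤t+1 = begin
  d         ≤⟨ d≤t+1 ⟩
  t + 1     ≤⟨ +-monoʳ-≤ t (+-cancelʳ-≤ 1 1 t (≤-trans 2≤d d≤t+1)) ⟩
  t + t     ≡⟨ cong (t +_) (+-identityʳ t) ⟨
  2 * t     ∎
  where open ≤-Reasoning

maxFin-ub : ∀ {n} (f : Fin n → ℕ) i → f i ≤ maxFin f
maxFin-ub {suc n} f Fin.zero    = m≤m⊔n _ _
maxFin-ub {suc n} f (Fin.suc i) = ≤-trans (maxFin-ub (λ j → f (Fin.suc j)) i) (m≤n⊔m _ _)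

maxFin-lub : ∀ {n} (f : Fin n → ℕ) {c} → (∀ i → f i ≤ c) → maxFin f ≤ c
maxFin-lub {zero}  f f≤c = z≤n
maxFin-lub {suc n} f f≤c = ⊔-lub (f≤c Fin.zero) (maxFin-lub (λ j → f (Fin.suc j)) (λ j → f≤c (Fin.suc j)))

≤-*-⌈/⌉ : ∀ a d → a ≤ suc d * ⌈ a / suc d ⌉
≤-*-⌈/⌉ a d = ≤-trans a≤q*[1+d] (≤-reflexive (*-comm q (suc d)))
  where
  q r : ℕ
  q = (a + d) / suc d
  r = (a + d) % suc d
  a+d≤q*[1+d]+d : a + d ≤ q * suc d + d
  a+d≤q*[1+d]+d = begin
    a + d           ≡⟨ m≡m%n+[m/n]*n (a + d) (suc d) ⟩
    r + q * suc d   ≤⟨ +-monoˡ-≤ (q * suc d) (≤-pred (m%n<n (a + d) (suc d))) ⟩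
    d + q * suc d   ≡⟨ +-comm d (q * suc d) ⟩
    q * suc d + d   ∎
    where open ≤-Reasoning
  a≤q*[1+d] : a ≤ q * suc d
  a≤q*[1+d] = +-cancelʳ-≤ d a (q * suc d) a+d≤q*[1+d]+d

subsetOf : ∀ {n} {P : Fin n → Set} → Decidable P → Subset n
subsetOf P? = tabulate (λ x → does (P? x))

module _ {n} {P : Fin n → Set} (P? : Decidable P) where

  ∈-subsetOf⁺ : ∀ {x} → P x → x ∈ subsetOf P?
  ∈-subsetOf⁺ {x} px = lookup⇒[]= x _ (trans (lookup∘tabulate _ x) (dec-true (P? x) px))

  ∈-subsetOf⁻ : ∀ {x} → x ∈ subsetOf P? → P x
  ∈-subsetOf⁻ {x} x∈ with P? x | trans (sym (lookup∘tabulate (λ y → does (P? y)) x)) ([]=⇒lookup x∈)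
  ... | yes px | _ = px
  ... | no _   | ()

-- An increasing sequence of decidable sets of elements of Fin n stops growing
-- somewhere: each strict increase adds an element, and there are only n of them.
module _ {n} (P : ℕ → Fin n → Set) (P? : ∀ i → Decidable (P i))
         (grows : ∀ i {x} → P i x → P (suc i) x) where

  private
    S : ℕ → Subset n
    S i = subsetOf (P? i)

    Stops : Set
    Stops = ∃ λ i → ∀ {x} → P (suc i) x → P i x

    growth : ∀ j → Stops ⊎ j ≤ ∣ S j ∣
    growth zero = inj₂ z≤n
    growth (suc j) with growth j | S j ⊂? S (suc j)
    ... | inj₁ stops  | _       = inj₁ stops
    ... | inj₂ j≤∣Sj∣ | yes S⊂S = inj₂ (≤-<-trans j≤∣Sj∣ (p⊂q⇒∣p∣<∣q∣ S⊂S))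
    ... | inj₂ _      | no S⊄S  = inj₁ (j , shrink)
      where
      shrink : ∀ {x} → P (suc j) x → P j x
      shrink {x} px with P? j x
      ... | yes px′ = px′
      ... | no ¬px′ = contradiction
        ((λ {y} y∈ → ∈-subsetOf⁺ (P? (suc j)) (grows j (∈-subsetOf⁻ (P? j) y∈))) ,
         x , ∈-subsetOf⁺ (P? (suc j)) px , ¬px′ ∘ ∈-subsetOf⁻ (P? j)) S⊄S

  stabilises : Stops
  stabilises with growth (suc n)
  ... | inj₁ stops = stops
  ... | inj₂ n<∣S∣ = contradiction (∣p∣≤n (S (suc n))) (<⇒≱ n<∣S∣)

member : ∀ {n} (p : Subset n) → 1 ≤ ∣ p ∣ → ∃ λ x → x ∈ p
member (true ∷ p)  _ = Fin.zero , here
member (false ∷ p) 1≤∣p∣ with member p 1≤∣p∣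
... | x , x∈p = Fin.suc x , there x∈p

two-members : ∀ {n} (p : Subset n) → 2 ≤ ∣ p ∣ → ∃₂ λ a b → a ≢ b × a ∈ p × b ∈ p
two-members (true ∷ p) (s≤s 1≤∣p∣) with member p 1≤∣p∣
... | b , b∈p = Fin.zero , Fin.suc b , (λ ()) , here , there b∈p
two-members (false ∷ p) 2≤∣p∣ with two-members p 2≤∣p∣
... | a , b , a≢b , a∈p , b∈p = Fin.suc a , Fin.suc b , a≢b ∘ suc-injective , there a∈p , there b∈p

module Images {n m} (H : Hypergraph n m) where

  IsEnd : Fin n → Fin n × Fin n → Set
  IsEnd y p = y ≡ proj₁ p ⊎ y ≡ proj₂ p

  isEnd? : ∀ y p → Dec (IsEnd y p)
  isEnd? y p = (y ≟ proj₁ p) ⊎-dec (y ≟ proj₂ p)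

  ValidEdge : Fin m → Fin n × Fin n → Set
  ValidEdge e p = proj₁ p ≢ proj₂ p × proj₁ p ∈ H e × proj₂ p ∈ H e

  image⁺ : ∀ {G} → (∀ e → ValidEdge e (G e)) → IsImage H G
  image⁺ valid = (λ e → proj₁ (valid e)) , (λ e → proj₂ (valid e))

  image⁻ : ∀ {G} → IsImage H G → ∀ e → ValidEdge e (G e)
  image⁻ (loopless , inside) e = loopless e , inside e

  some-image : (∀ e → 2 ≤ ∣ H e ∣) → Σ (Multigraph n m) (IsImage H)
  some-image 2≤∣He∣ = G , image⁺ valid
    where
    G : Multigraph n m
    G e = proj₁ (two-members (H e) (2≤∣He∣ e)) , proj₁ (proj₂ (two-members (H e) (2≤∣He∣ e)))
    valid : ∀ e → ValidEdge e (G e)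
    valid e = proj₂ (proj₂ (two-members (H e) (2≤∣He∣ e)))

  ends : Fin n → Fin n × Fin n → ℕ
  ends y p = 𝟙[ y ≡ proj₁ p ] + 𝟙[ y ≡ proj₂ p ]

  degree : Multigraph n m → Fin n → ℕ
  degree G y = ∑[ e < m ] ends y (G e)

  ∑-ends : (w : Fin n → ℕ) (p : Fin n × Fin n) → ∑[ u < n ] (w u * ends u p) ≡ w (proj₁ p) + w (proj₂ p)
  ∑-ends w (a , b) = begin
    ∑[ u < n ] (w u * (𝟙[ u ≡ a ] + 𝟙[ u ≡ b ]))
      ≡⟨ sum-cong-≗ (λ u → *-distribˡ-+ (w u) _ _) ⟩
    ∑[ u < n ] (w u * 𝟙[ u ≡ a ] + w u * 𝟙[ u ≡ b ])
      ≡⟨ ∑-distrib-+ (λ u → w u * 𝟙[ u ≡ a ]) _ ⟩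
    ∑[ u < n ] (w u * 𝟙[ u ≡ a ]) + ∑[ u < n ] (w u * 𝟙[ u ≡ b ])
      ≡⟨ cong₂ _+_ (sum-indicator w a) (sum-indicator w b) ⟩
    w a + w b
      ∎
    where open ≡-Reasoning

  gdeg≡degree : ∀ {G} → Loopless G → ∀ y → gdeg G y ≡ degree G y
  gdeg≡degree {G} loopless y =
    trans (count-sum (λ e → does (y ≟ proj₁ (G e)) ∨ does (y ≟ proj₂ (G e))))
          (sum-cong-≗ (λ e → incident (loopless e)))
    where
    incident : ∀ {a b} → a ≢ b → b2n (does (y ≟ a) ∨ does (y ≟ b)) ≡ ends y (a , b)
    incident {a} {b} a≢b with y ≟ a | y ≟ b
    ... | yes refl | yes refl = contradiction refl a≢b
    ... | yes _    | no _     = refl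
    ... | no _     | yes _    = refl
    ... | no _     | no _     = refl

  Shifted : Multigraph n m → Multigraph n m → Fin n → Fin n → Set
  Shifted G G′ v x = ∀ y → degree G′ y + 𝟙[ y ≡ v ] ≡ degree G y + 𝟙[ y ≡ x ]

  Shifted-trans : ∀ {G G₁ G₂ v u x} → Shifted G G₁ u x → Shifted G₁ G₂ v u → Shifted G G₂ v x
  Shifted-trans G→G₁ G₁→G₂ y = trans (G₁→G₂ y) (G→G₁ y)

  turn : ∀ {u} (p : Fin n × Fin n) → IsEnd u p → Fin n → Fin n × Fin n
  turn (a , b) (inj₁ _) x = x , b
  turn (a , b) (inj₂ _) x = a , x

  ends-turn : ∀ {u} p (u∈p : IsEnd u p) x y → ends y (turn p u∈p x) + 𝟙[ y ≡ u ] ≡ ends y p + 𝟙[ y ≡ x ]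
  ends-turn (a , b) (inj₁ refl) x y = xy∙z≈zy∙x 𝟙[ y ≡ x ] 𝟙[ y ≡ b ] 𝟙[ y ≡ a ]
  ends-turn (a , b) (inj₂ refl) x y = xy∙z≈xz∙y 𝟙[ y ≡ a ] 𝟙[ y ≡ x ] 𝟙[ y ≡ b ]

  turn-valid : ∀ {e u x} p (u∈p : IsEnd u p) → ValidEdge e p → x ∈ H e → ¬ IsEnd x p →
               ValidEdge e (turn p u∈p x)
  turn-valid (a , b) (inj₁ _) (_ , _ , b∈He) x∈He x∉p = x∉p ∘ inj₂ , x∈He , b∈He
  turn-valid (a , b) (inj₂ _) (_ , a∈He , _) x∈He x∉p = x∉p ∘ inj₁ ∘ sym , a∈He , x∈He

  Step : Multigraph n m → Fin n → Fin m → Fin n → Set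
  Step G u e x = IsEnd u (G e) × x ∈ H e × ¬ IsEnd x (G e)

  step? : ∀ G u e x → Dec (Step G u e x)
  step? G u e x = isEnd? u (G e) ×-dec (x ∈? H e) ×-dec ¬? (isEnd? x (G e))

  turned : (G : Multigraph n m) → ∀ {u e x} → Step G u e x → Multigraph n m
  turned G {e = e} {x} (u∈Ge , _) = updateAt G e (λ _ → turn (G e) u∈Ge x)

  turned-agrees : ∀ G {u e x} (st : Step G u e x) → ∀ e′ → e′ ≢ e → turned G st e′ ≡ G e′
  turned-agrees G {e = e} st e′ e′≢e = updateAt-minimal e′ e G e′≢e

  turned-image : ∀ {G u e x} (st : Step G u e x) → IsImage H G → IsImage H (turned G st)
  turned-image {G} {e = e} st@(u∈Ge , x∈He , x∉Ge) img = image⁺ valid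
    where
    valid : ∀ e′ → ValidEdge e′ (turned G st e′)
    valid e′ with e′ ≟ e
    ... | yes refl = subst (ValidEdge e) (sym (updateAt-updates e G))
                           (turn-valid (G e) u∈Ge (image⁻ img e) x∈He x∉Ge)
    ... | no e′≢e  = subst (ValidEdge e′) (sym (turned-agrees G st e′ e′≢e)) (image⁻ img e′)

  turned-shifted : ∀ {G u e x} (st : Step G u e x) → Shifted G (turned G st) u x
  turned-shifted {G} {u} {e} {x} st@(u∈Ge , _) y = +-cancelʳ-≡ (ends y (G e)) _ _ (begin
    degree G₁ y + 𝟙[ y ≡ u ] + ends y (G e)           ≡⟨ xy∙z≈xz∙y (degree G₁ y) _ _ ⟩
    degree G₁ y + ends y (G e) + 𝟙[ y ≡ u ]           ≡⟨ cong (_+ 𝟙[ y ≡ u ]) updated ⟩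
    degree G y + ends y (G₁ e) + 𝟙[ y ≡ u ]           ≡⟨ +-assoc (degree G y) _ _ ⟩
    degree G y + (ends y (G₁ e) + 𝟙[ y ≡ u ])         ≡⟨ cong (λ p → degree G y + (ends y p + 𝟙[ y ≡ u ]))
                                                                (updateAt-updates e G) ⟩
    degree G y + (ends y (turn (G e) u∈Ge x) + 𝟙[ y ≡ u ]) ≡⟨ cong (degree G y +_) (ends-turn (G e) u∈Ge x y) ⟩
    degree G y + (ends y (G e) + 𝟙[ y ≡ x ])         ≡⟨ x∙yz≈xz∙y (degree G y) _ _ ⟩
    degree G y + 𝟙[ y ≡ x ] + ends y (G e)           ∎)
    where
    open ≡-Reasoning
    G₁ : Multigraph n m
    G₁ = turned G st
    updated : degree G₁ y + ends y (G e) ≡ degree G y + ends y (G₁ e)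
    updated = sum-update e (λ e′ e′≢e → cong (ends y) (turned-agrees G st e′ e′≢e))

  Level : Multigraph n m → Fin n → ℕ → Fin n → Set
  Level G v zero    x = x ≡ v
  Level G v (suc i) x = Level G v i x ⊎ ∃ λ u → Level G v i u × ∃ λ e → Step G u e x

  level? : ∀ G v i → Decidable (Level G v i)
  level? G v zero    x = x ≟ v
  level? G v (suc i) x =
    level? G v i x ⊎-dec any? (λ u → level? G v i u ×-dec any? (λ e → step? G u e x))

  level-root : ∀ G v i → Level G v i v
  level-root G v zero    = refl
  level-root G v (suc i) = inj₁ (level-root G v i)

  -- Replacing an edge e that no vertex within i steps of v touches keeps every
  -- vertex within i + 1 steps of v (every path of that length avoids using e).
  module Survival (G G₁ : Multigraph n m) (v : Fin n) (e : Fin m)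
                  (agree : ∀ e′ → e′ ≢ e → G₁ e′ ≡ G e′) where

    Avoids : ℕ → Set
    Avoids i = ∀ {z} → Level G v i z → ¬ IsEnd z (G e)

    survives : ∀ i → Avoids i → ∀ {x} → Level G v i x → Level G₁ v i x
    survives-next : ∀ i → Avoids i → ∀ {x} → Level G v (suc i) x → Level G₁ v (suc i) x

    survives zero    _     ℓ = ℓ
    survives (suc i) avoid ℓ = survives-next i (avoid ∘ inj₁) ℓ

    survives-next i avoid (inj₁ ℓ) = inj₁ (survives i avoid ℓ)
    survives-next i avoid {x} (inj₂ (u , ℓ , e′ , st)) =
      inj₂ (u , survives i avoid ℓ , e′ ,
            subst (λ p → IsEnd u p × x ∈ H e′ × ¬ IsEnd x p) (sym (agree e′ e′≢e)) st)
      where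
      e′≢e : e′ ≢ e
      e′≢e refl = avoid ℓ (proj₁ st)

  -- If x is not within j steps of v but u is, then turning an edge from u to x
  -- keeps u within j steps of v: a shortest path to u avoids that edge.
  reached-after-turn : ∀ {G v u e x} (st : Step G u e x) j →
                       Level G v j u → ¬ Level G v j x → Level (turned G st) v j u
  reached-after-turn         st zero    ℓu _   = ℓu
  reached-after-turn {G} {v} {e = e} st (suc j) ℓu ¬ℓx =
    Survival.survives-next G (turned G st) v e (turned-agrees G st) j
      (λ ℓz z∈Ge → ¬ℓx (inj₂ (_ , ℓz , e , z∈Ge , proj₂ st))) ℓu

  -- Augmenting along a shortest path: for every vertex x reachable from v there is
  -- an image that moves one unit of degree from v to x: turn the last edge of a
  -- shortest path to x, then recurse on the (still available) rest of the path.
  shift : ∀ v i G → IsImage H G → ∀ {x} → Level G v i x →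
          ∃ λ G′ → IsImage H G′ × Shifted G G′ v x
  shift v zero    G img refl     = G , img , λ _ → refl
  shift v (suc i) G img (inj₁ ℓ) = shift v i G img ℓ
  shift v (suc i) G img {x} (inj₂ (u , ℓu , e , st)) with level? G v i x
  ... | yes ℓx = shift v i G img ℓx
  ... | no ¬ℓx with shift v i (turned G st) (turned-image st img) (reached-after-turn st i ℓu ¬ℓx)
  ... | G′ , img′ , shifted = G′ , img′ , Shifted-trans (turned-shifted st) shifted

-- Let S be a set of vertices closed under steps in a
-- multigraph G.  An edge with one endpoint in S has all other vertices of its
-- hyperedge in S, so it meets S in at least δ - 1 ≥ δ/2 vertices; an edge with
-- both endpoints in S meets S in at least δ vertices.  Summing over the edges,
-- δ times the total G-degree of S is at most twice its total H-degree.
module Counting {n m} (H : Hypergraph n m) {δ} (2≤δ : 2 ≤ δ) (δ≤∣He∣ : ∀ e → δ ≤ ∣ H e ∣) where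
  open Images H

  Closed : Multigraph n m → (Fin n → Set) → Set
  Closed G S = ∀ {u e x} → S u → Step G u e x → S x

  module _ {G : Multigraph n m} {S : Fin n → Set} (S? : Decidable S) (closed : Closed G S) where

    w : Fin n → ℕ
    w u = b2n (does (S? u))

    inside : Fin m → ℕ
    inside e = ∑[ u < n ] (w u * 𝟙[ u ∈ H e ])

    cover : ∀ e (X : Fin n → ℕ) → (∀ u → u ∈ H e → S u ⊎ 1 ≤ X u) →
            δ ≤ inside e + ∑[ u < n ] X u
    cover e X paid = begin
      δ                                        ≤⟨ δ≤∣He∣ e ⟩
      ∣ H e ∣                                  ≡⟨ card-sum (H e) ⟩
      ∑[ u < n ] 𝟙[ u ∈ H e ]                  ≤⟨ sum-mono-≤ pointwise ⟩
      ∑[ u < n ] (w u * 𝟙[ u ∈ H e ] + X u)    ≡⟨ ∑-distrib-+ (λ u → w u * 𝟙[ u ∈ H e ]) X ⟩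
      inside e + ∑[ u < n ] X u                ∎
      where
      open ≤-Reasoning
      pointwise : ∀ u → 𝟙[ u ∈ H e ] ≤ w u * 𝟙[ u ∈ H e ] + X u
      pointwise u with u ∈? H e | S? u
      ... | no _    | _      = z≤n
      ... | yes _   | yes _  = s≤s z≤n
      ... | yes u∈e | no ¬Su with paid u u∈e
      ...   | inj₁ Su  = contradiction Su ¬Su
      ...   | inj₂ 1≤X = 1≤X

    in-S-or-end : ∀ {e} → S (proj₁ (G e)) ⊎ S (proj₂ (G e)) → ∀ u → u ∈ H e → S u ⊎ IsEnd u (G e)
    in-S-or-end {e} S-end u u∈e with isEnd? u (G e)
    ... | yes u-end = inj₂ u-end
    ... | no ¬u-end with S-end
    ...   | inj₁ Sa = inj₁ (closed Sa (inj₁ refl , u∈e , ¬u-end))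
    ...   | inj₂ Sb = inj₁ (closed Sb (inj₂ refl , u∈e , ¬u-end))

    half-load : ∀ {e} c → δ ≤ inside e + ∑[ u < n ] 𝟙[ u ≡ c ] → δ * 1 ≤ 2 * inside e
    half-load {e} c δ≤ = ≤-trans (≤-reflexive (*-identityʳ δ))
                                 (≤-double 2≤δ (subst (δ ≤_) (cong (inside e +_) (sum-𝟙 c)) δ≤))

    edge-load : ∀ e → δ * (w (proj₁ (G e)) + w (proj₂ (G e))) ≤ 2 * inside e
    edge-load e with S? (proj₁ (G e)) | S? (proj₂ (G e))
    ... | no _   | no _   = ≤-trans (≤-reflexive (*-zeroʳ δ)) z≤n
    ... | yes Sa | yes Sb = ≤-trans (≤-reflexive (*-comm δ 2)) (*-monoʳ-≤ 2 δ≤inside)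
      where
      paid : ∀ u → u ∈ H e → S u ⊎ 1 ≤ 0
      paid u u∈e with in-S-or-end (inj₁ Sa) u u∈e
      ... | inj₁ Su        = inj₁ Su
      ... | inj₂ (inj₁ refl) = inj₁ Sa
      ... | inj₂ (inj₂ refl) = inj₁ Sb
      δ≤inside : δ ≤ inside e
      δ≤inside = subst (δ ≤_) (trans (cong (inside e +_) (sum-replicate-zero n)) (+-identityʳ _))
                       (cover e (λ _ → 0) paid)
    ... | yes Sa | no ¬Sb = half-load _ (cover e (λ u → 𝟙[ u ≡ proj₂ (G e) ]) paid)
      where
      paid : ∀ u → u ∈ H e → S u ⊎ 1 ≤ 𝟙[ u ≡ proj₂ (G e) ]
      paid u u∈e with in-S-or-end (inj₁ Sa) u u∈e
      ... | inj₁ Su          = inj₁ Su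
      ... | inj₂ (inj₁ refl) = inj₁ Sa
      ... | inj₂ (inj₂ refl) = inj₂ (≤-reflexive (sym (𝟙[≡]-refl u)))
    ... | no ¬Sa | yes Sb = half-load _ (cover e (λ u → 𝟙[ u ≡ proj₁ (G e) ]) paid)
      where
      paid : ∀ u → u ∈ H e → S u ⊎ 1 ≤ 𝟙[ u ≡ proj₁ (G e) ]
      paid u u∈e with in-S-or-end (inj₂ Sb) u u∈e
      ... | inj₁ Su          = inj₁ Su
      ... | inj₂ (inj₁ refl) = inj₂ (≤-reflexive (sym (𝟙[≡]-refl u)))
      ... | inj₂ (inj₂ refl) = inj₁ Sb

    closed-load : δ * ∑[ u < n ] (w u * degree G u) ≤ 2 * ∑[ u < n ] (w u * hdeg H u)
    closed-load = begin
      δ * ∑[ u < n ] (w u * degree G u)        ≡⟨ cong (δ *_) G-side ⟩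
      δ * ∑[ e < m ] ends-in-S e               ≡⟨ *-distribˡ-sum δ ends-in-S ⟩
      ∑[ e < m ] (δ * ends-in-S e)             ≤⟨ sum-mono-≤ edge-load ⟩
      ∑[ e < m ] (2 * inside e)                ≡⟨ *-distribˡ-sum 2 inside ⟨
      2 * ∑[ e < m ] inside e                  ≡⟨ cong (2 *_) H-side ⟨
      2 * ∑[ u < n ] (w u * hdeg H u)          ∎
      where
      open ≤-Reasoning
      ends-in-S : Fin m → ℕ
      ends-in-S e = w (proj₁ (G e)) + w (proj₂ (G e))
      G-side : ∑[ u < n ] (w u * degree G u) ≡ ∑[ e < m ] ends-in-S e
      G-side = trans (∑-weighted-comm w (λ u e → ends u (G e))) (sum-cong-≗ (λ e → ∑-ends w (G e)))
      H-side : ∑[ u < n ] (w u * hdeg H u) ≡ ∑[ e < m ] inside e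
      H-side = trans (sum-cong-≗ (λ u → cong (w u *_) (count-sum (λ e → does (u ∈? H e)))))
                     (∑-weighted-comm w (λ u e → 𝟙[ u ∈ H e ]))

    no-overfull : ∀ {k v} → 2 * maxDegH H ≤ δ * k →
                  (∀ u → S u → k ≤ degree G u) → S v → k < degree G v → ⊥
    no-overfull {k} {v} 2Δ≤δk full Sv k<v =
      <-irrefl refl (*-cancelˡ-≤ δ {{>-nonZero (≤-trans (s≤s z≤n) 2≤δ)}} (begin
      δ * suc (N * k)                     ≤⟨ *-monoʳ-≤ δ lower ⟩
      δ * ∑[ u < n ] (w u * degree G u)   ≤⟨ closed-load ⟩
      2 * ∑[ u < n ] (w u * hdeg H u)     ≤⟨ *-monoʳ-≤ 2 upper ⟩
      2 * (N * Δ)                         ≡⟨ x∙yz≈y∙xz 2 N Δ ⟩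
      N * (2 * Δ)                         ≤⟨ *-monoʳ-≤ N 2Δ≤δk ⟩
      N * (δ * k)                         ≡⟨ x∙yz≈y∙xz N δ k ⟩
      δ * (N * k)                         ∎))
      where
      open ≤-Reasoning
      Δ N : ℕ
      Δ = maxDegH H
      N = ∑[ u < n ] w u

      k+𝟙≤degree : ∀ u → S u → k + 𝟙[ u ≡ v ] ≤ degree G u
      k+𝟙≤degree u Su with u ≟ v
      ... | yes refl = ≤-trans (≤-reflexive (+-comm k 1)) k<v
      ... | no _     = ≤-trans (≤-reflexive (+-identityʳ k)) (full u Su)

      pointwise : ∀ u → w u * k + 𝟙[ u ≡ v ] ≤ w u * degree G u
      pointwise u with S? u
      ... | yes Su = subst₂ _≤_ (cong (_+ 𝟙[ u ≡ v ]) (sym (*-identityˡ k))) (sym (*-identityˡ _))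
                                (k+𝟙≤degree u Su)
      ... | no ¬Su with u ≟ v
      ...   | yes refl = contradiction Sv ¬Su
      ...   | no _     = z≤n

      lower : suc (N * k) ≤ ∑[ u < n ] (w u * degree G u)
      lower = begin
        suc (N * k)                                           ≡⟨ +-comm 1 (N * k) ⟩
        N * k + 1                                             ≡⟨ cong₂ _+_ (*-distribʳ-sum k w) (sym (sum-𝟙 v)) ⟩
        ∑[ u < n ] (w u * k) + ∑[ u < n ] 𝟙[ u ≡ v ]          ≡⟨ ∑-distrib-+ (λ u → w u * k) _ ⟨
        ∑[ u < n ] (w u * k + 𝟙[ u ≡ v ])                     ≤⟨ sum-mono-≤ pointwise ⟩
        ∑[ u < n ] (w u * degree G u)                         ∎

      upper : ∑[ u < n ] (w u * hdeg H u) ≤ N * Δ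
      upper = begin
        ∑[ u < n ] (w u * hdeg H u)   ≤⟨ sum-mono-≤ (λ u → *-monoʳ-≤ (w u) (maxFin-ub (hdeg H) u)) ⟩
        ∑[ u < n ] (w u * Δ)          ≡⟨ *-distribʳ-sum Δ w ⟨
        N * Δ                         ∎

-- Balancing: starting from any image, repeatedly move degree from a vertex above k
-- to a vertex below k until no vertex exceeds k.  The total excess over k drops
-- in each round, and by the counting argument a round is always possible.
module Balancing {n m} (H : Hypergraph n m) {δ k} (2≤δ : 2 ≤ δ) (δ≤∣He∣ : ∀ e → δ ≤ ∣ H e ∣)
                 (2Δ≤δk : 2 * maxDegH H ≤ δ * k) where
  open Images H
  open Counting H 2≤δ δ≤∣He∣

  excess : Multigraph n m → ℕ
  excess G = ∑[ y < n ] (degree G y ∸ k)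

  excess-drop : ∀ {G G′ v x} → Shifted G G′ v x → k < degree G v → degree G x < k → excess G′ < excess G
  excess-drop {G} {G′} {v} {x} shifted k<v x<k = sum-mono-< pointwise v at-v
    where
    -- v loses one unit of degree and stays at least k.
    at-v : degree G′ v ∸ k < degree G v ∸ k
    at-v with v ≟ v | v ≟ x | shifted v
    ... | no v≢v | _        | _  = contradiction refl v≢v
    ... | yes _  | yes refl | _  = contradiction k<v (<-asym x<k)
    ... | yes _  | no _     | eq =
      ∸-monoˡ-< (≤-reflexive suc-d′≡d) (≤-pred (≤-trans k<v (≤-reflexive (sym suc-d′≡d))))
      where
      suc-d′≡d : suc (degree G′ v) ≡ degree G v
      suc-d′≡d = trans (+-comm 1 _) (trans eq (+-identityʳ _))

    -- x gains one unit of degree and stays at most k; all other degrees are unchanged.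
    pointwise : ∀ y → degree G′ y ∸ k ≤ degree G y ∸ k
    pointwise y with y ≟ v | y ≟ x | shifted y
    ... | yes refl | _        | _  = <⇒≤ at-v
    ... | no _     | yes refl | eq = ≤-trans (≤-reflexive (m≤n⇒m∸n≡0 d′≤k)) z≤n
      where
      d′≤k : degree G′ y ≤ k
      d′≤k = ≤-trans (≤-reflexive (trans (sym (+-identityʳ _)) (trans eq (+-comm _ 1)))) x<k
    ... | no _     | no _     | eq = ∸-monoˡ-≤ k (≤-reflexive (+-cancelʳ-≡ 0 _ _ eq))

  -- Let the search from an overfull vertex v stabilise at
  -- level i; the vertices within i steps form a closed set.  If one of them has
  -- degree below k, shift a unit of degree to it; otherwise the counting
  -- argument rules the situation out.
  improve : ∀ G → IsImage H G → ∀ v → k < degree G v →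
            ∃ λ G′ → IsImage H G′ × excess G′ < excess G
  improve G img v k<v with stabilises (Level G v) (level? G v) (λ i → inj₁)
  ... | i , stable with any? (λ x → level? G v i x ×-dec (degree G x <? k))
  ... | yes (x , ℓx , x<k) with shift v i G img ℓx
  ...   | G′ , img′ , shifted = G′ , img′ , excess-drop shifted k<v x<k
  improve G img v k<v | i , stable | no none =
    ⊥-elim (no-overfull (level? G v i) closed 2Δ≤δk full (level-root G v i) k<v)
    where
    closed : Closed G (Level G v i)
    closed ℓu st = stable (inj₂ (_ , ℓu , _ , st))
    full : ∀ u → Level G v i u → k ≤ degree G u
    full u ℓu = ≮⇒≥ (λ u<k → none (u , ℓu , u<k))

  balance : ∀ G → IsImage H G → Acc _<_ (excess G) →
            ∃ λ G′ → IsImage H G′ × (∀ y → degree G′ y ≤ k)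
  balance G img (acc smaller) with all? (λ y → degree G y ≤? k)
  ... | yes bounded = G , img , bounded
  ... | no unbounded with ¬∀⟶∃¬ n _ (λ y → degree G y ≤? k) unbounded
  ...   | v , v≰k with improve G img v (≰⇒> v≰k)
  ...     | G′ , img′ , dropped = balance G′ img′ (smaller dropped)

lemma1 : (n m : ℕ) (H : Hypergraph n m) (δ : ℕ) → 2 ≤ δ →
         (∀ e → δ ≤ ∣ H e ∣) →
         Σ (Multigraph n m) (λ G → IsImage H G × (maxDegG G ≤ ⌈ 2 * maxDegH H / δ ⌉))
lemma1 n m H (suc d) 2≤δ δ≤∣He∣ = G , img , maxFin-lub (gdeg G) degree-bound
  where
  open Images H
  k : ℕ
  k = ⌈ 2 * maxDegH H / suc d ⌉
  open Balancing H 2≤δ δ≤∣He∣ (≤-*-⌈/⌉ (2 * maxDegH H) d)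
  start : Σ (Multigraph n m) (IsImage H)
  start = some-image (λ e → ≤-trans 2≤δ (δ≤∣He∣ e))
  balanced : ∃ λ G → IsImage H G × (∀ y → degree G y ≤ k)
  balanced = balance (proj₁ start) (proj₂ start) (<-wellFounded _)
  G : Multigraph n m
  G = proj₁ balanced
  img : IsImage H G
  img = proj₁ (proj₂ balanced)
  degree-bound : ∀ y → gdeg G y ≤ k
  degree-bound y = subst (_≤ k) (sym (gdeg≡degree (proj₁ img) y)) (proj₂ (proj₂ balanced) y)
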